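{- For every integer partition $\lambda$ with $|\lambda|$ parts-sum and $l(\lambda)$ parts, \[u_{P_\lambda}(m)=\sum_{i=l(\lambda)}^{|\lambda|}(-1)^{|\lambda|-i}\binom{|\lambda|-l(\lambda)}{i-l(\lambda)}\,m(m+1)\cdots(m+i-1).\]
   Context: $P_\lambda$, for $\lambda=(\lambda_1,\ldots,\lambda_k)$, is the digraph that is the vertex-disjoint union of directed paths with $\lambda_1,\ldots,\lambda_k$ vertices. For a digraph $X=(V,E)$, $U_X=\sum_\sigma F_{X\mathrm{Des}(\sigma)}$, summed over listings $\sigma$ of $V$, with $X\mathrm{Des}(\sigma)=\{i:(\sigma_i,\sigma_{i+1})\in E\}$ and $F_I$ the fundamental quasisymmetric function; the Redei-Berge polynomial is $u_X(m)=U_X(1^m,0,0,\ldots)$. -}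

module Defs where

open import Data.Bool using (Bool; true; false; _∧_; if_then_else_; not)
open import Data.Nat using (ℕ; zero; suc; _+_; _*_; _∸_; _<ᵇ_; _≤ᵇ_; _≡ᵇ_; _≥_)
open import Data.Nat.Combinatorics using (_C_)
open import Data.Fin using (Fin; toℕ)
open import Data.Nat.ListAction using (sum)
open import Data.List using (List; []; _∷_; map; length; filter; concatMap; upTo; allFin; foldr)
open import Data.Integer as ℤ using (ℤ)
open import Relation.Nullary.Decidable using (does)
open import Relation.Binary.PropositionalEquality using (_≡_)
open import Data.Bool using (T)

record Digraph : Set where
  field
    size : ℕ
    edge : Fin size → Fin size → Bool
open Digraph public

allSeqs : (k n : ℕ) → List (List (Fin k))
allSeqs k zero    = [] ∷ []
allSeqs k (suc n) = concatMap (λ x → map (x ∷_) (allSeqs k n)) (allFin k)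

notIn : ∀ {n} → Fin n → List (Fin n) → Bool
notIn x []       = true
notIn x (y ∷ ys) = not (toℕ x ≡ᵇ toℕ y) ∧ notIn x ys

distinct : ∀ {n} → List (Fin n) → Bool
distinct []       = true
distinct (x ∷ xs) = notIn x xs ∧ distinct xs

-- listings of the vertex set V = Fin n: sequences of length n
-- that contain every vertex exactly once (= distinct entries)
listings : (n : ℕ) → List (List (Fin n))
listings n = filter (λ σ → T? (distinct σ)) (allSeqs n n)
  where
  open import Data.Bool.Properties using (T?)

-- Principal specialisation F_I(1^m,0,0,...) of the fundamental
-- quasisymmetric function F_I of degree n, where I ⊆ [n-1] is the
-- X-descent set of the listing σ:
--   F_I(1^m) = #{ 1 ≤ i_1 ≤ ... ≤ i_n ≤ m : i_j < i_{j+1} for j ∈ I }.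
-- Values i_j ∈ {1..m} are represented by Fin m.
-- compatible X σ s : s is weakly increasing along σ, strictly at X-descents
compatible : (X : Digraph) {m : ℕ} → List (Fin (size X)) → List (Fin m) → Bool
compatible X (a ∷ b ∷ σ) (x ∷ y ∷ s) =
  (if edge X a b then toℕ x <ᵇ toℕ y else toℕ x ≤ᵇ toℕ y) ∧ compatible X (b ∷ σ) (y ∷ s)
compatible X _ _ = true

count : ∀ {A : Set} → (A → Bool) → List A → ℕ
count p []       = 0
count p (x ∷ xs) = (if p x then 1 else 0) + count p xs

F-spec : (X : Digraph) (m : ℕ) → List (Fin (size X)) → ℕ
F-spec X m σ = count (compatible X σ) (allSeqs m (size X))

-- Redei–Berge polynomial evaluated at m : u_X(m) = U_X(1^m,0,0,...)
redeiBerge : Digraph → ℕ → ℕ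
redeiBerge X m = sum (map (F-spec X m) (listings (size X)))

-- P_λ : disjoint union of directed paths with λ_1,…,λ_k vertices.
-- Vertices 0..|λ|-1; the first λ_1 vertices form the path
-- 0→1→…→λ_1-1, the next λ_2 vertices the next path, etc.

isLastInBlock : List ℕ → ℕ → Bool
isLastInBlock []       k = true
isLastInBlock (p ∷ ps) k = if k <ᵇ p then suc k ≡ᵇ p else isLastInBlock ps (k ∸ p)

P : List ℕ → Digraph
P λs = record
  { size = sum λs
  ; edge = λ a b → (toℕ b ≡ᵇ suc (toℕ a)) ∧ not (isLastInBlock λs (toℕ a)) }

data Decreasing : List ℕ → Set where
  []  : Decreasing []
  [-] : ∀ {x} → Decreasing (x ∷ [])
  _∷_ : ∀ {x y xs} → x ≥ y → Decreasing (y ∷ xs) → Decreasing (x ∷ y ∷ xs)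

data AllPos : List ℕ → Set where
  []  : AllPos []
  _∷_ : ∀ {x xs} → 0 Data.Nat.< x → AllPos xs → AllPos (x ∷ xs)

IsPartition : List ℕ → Set
IsPartition λs = Decreasing λs Data.Product.× AllPos λs
  where import Data.Product

rising : ℕ → ℕ → ℕ
rising m zero    = 1
rising m (suc i) = rising m i * (m + i)

sign : ℕ → ℤ
sign zero          = ℤ.+ 1
sign (suc zero)    = ℤ.- (ℤ.+ 1)
sign (suc (suc k)) = sign k

-- Σ_{i=l}^{N} (-1)^{N-i} C(N-l, i-l) m(m+1)⋯(m+i-1),  with i = l + j, 0 ≤ j ≤ N-l
rhs : (N l m : ℕ) → ℤ
rhs N l m = foldr ℤ._+_ (ℤ.+ 0)
  (map (λ j → sign (N ∸ (l + j)) ℤ.* ℤ.+ (((N ∸ l) C j) * rising m (l + j)))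
       (upTo (suc (N ∸ l))))

module Submission where

open import Data.Bool using (Bool; true; false; _∧_; not; if_then_else_; T)
open import Data.Bool.Properties using (T?; ∧-conicalˡ; ∧-conicalʳ; ∧-zeroʳ; not-involutive; ¬-not)
  renaming (_≟_ to _≟ᵇ_)
open import Data.Fin as Fin using (Fin; zero; suc; toℕ; fromℕ; inject₁)
open import Data.Fin.Permutation as Perm
  using (Permutation; _⟨$⟩ʳ_; _⟨$⟩ˡ_; inverseˡ; transpose; insert; insert-punchIn)
open import Data.Fin.Properties as Finₚ
  using (toℕ-injective; injective⇒≤; toℕ-fromℕ; toℕ-inject₁; toℕ<n)
open import Data.Integer as ℤ using (ℤ; -_)
import Data.Integer.Properties as ℤₚ
open import Data.Integer.Solver using () renaming (module +-*-Solver to ℤ-Solver)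
open import Data.List
  using (List; []; _∷_; _++_; map; length; filter; concatMap; tabulate; allFin; lookup; foldr; applyUpTo)
open import Data.List.Properties using (map-++; map-∘; map-id; map-tabulate; length-map)
open import Data.List.Relation.Unary.Linked using (Linked; []; [-]; _∷_)
open import Data.Nat as ℕ using (ℕ; zero; suc; _+_; _*_; _∸_; _≤_; _<_; s≤s; _≡ᵇ_; _<ᵇ_; _≤ᵇ_; _!)
open import Data.Nat.Combinatorics using (_C_; nCk+nC[k+1]≡[n+1]C[k+1]; k>n⇒nCk≡0)
open import Data.Nat.ListAction using (sum)
open import Data.Nat.ListAction.Properties using (sum-++)
open import Data.Nat.Properties
open import Data.Nat.Solver using (module +-*-Solver)
open import Data.Product using (Σ; _,_)
open import Function using (_∘_; Injective)
open import Relation.Binary.PropositionalEquality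
open import Relation.Nullary using (yes; no; contradiction)
open import Relation.Nullary.Decidable using (dec-true; dec-false)

open import Algebra.Properties.CommutativeSemigroup *-commutativeSemigroup using (x∙yz≈y∙xz)
open import Algebra.Properties.CommutativeSemigroup +-commutativeSemigroup
  using () renaming (xy∙z≈xz∙y to [x+y]+z≡[x+z]+y)
open import Algebra.Properties.Semiring.Sum +-*-semiring
  using (sum-syntax; sum-cong-≗; ∑-distrib-+; ∑-permute; *-distribˡ-sum)
import Algebra.Properties.Semiring.Sum ℤₚ.+-*-semiring as ℤΣ

open import Defs

-- u_X(m) counts the pairs (σ, s) of a listing σ of X and a sequence s of values in
-- {1,…,m} that weakly increases along σ and strictly at X-descents.  For a
-- disjoint union of paths i → i+1, delete an edge e = (0 → 1): the new pairs are
-- exactly those where σ visits 0 and then 1 with equal values there, and merging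
-- 0 and 1 identifies them with the pairs of the contraction X/e.  Hence
-- u_{X∖e} = u_X + u_{X/e}, and both X∖e and X/e have one edge less.  Without
-- edges, u(m) = n!·C(m+n-1, n) = m(m+1)⋯(m+n-1), so induction on the number e of
-- edges makes u_X the e-th forward difference of rising factorials,
-- Σ_j (-1)^(e-j) C(e,j) m(m+1)⋯(m+n-e+j-1); a cyclic relabelling brings any edge
-- to the position 0 → 1.  For P_λ there are |λ| − l(λ) edges.

𝟙 : Bool → ℕ
𝟙 b = if b then 1 else 0

𝟙-∧ : ∀ a b → 𝟙 (a ∧ b) ≡ 𝟙 a * 𝟙 b
𝟙-∧ true  b = sym (+-identityʳ (𝟙 b))
𝟙-∧ false b = refl

𝟙-∧-* : ∀ a b c → 𝟙 (a ∧ b) * c ≡ 𝟙 a * (𝟙 b * c)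
𝟙-∧-* true  b c = sym (+-identityʳ (𝟙 b * c))
𝟙-∧-* false b c = refl

𝟙-guard : ∀ b {c d} → (b ≡ true → c ≡ d) → 𝟙 b * c ≡ 𝟙 b * d
𝟙-guard true  c≡d = cong (1 *_) (c≡d refl)
𝟙-guard false _   = refl

𝟙-split : ∀ b c → c ≡ 𝟙 b * c + 𝟙 (not b) * c
𝟙-split true  c = sym (trans (+-identityʳ _) (+-identityʳ c))
𝟙-split false c = sym (+-identityʳ c)

∑-const : ∀ k c → ∑[ i < k ] c ≡ k * c
∑-const zero    c = refl
∑-const (suc k) c = cong (c +_) (∑-const k c)

∑-zero : ∀ k → ∑[ i < k ] 0 ≡ 0
∑-zero k = trans (∑-const k 0) (*-zeroʳ k)

∑-weighted-+ : ∀ k (c f g h : Fin k → ℕ) → (∀ b → f b ≡ g b + h b) →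
  ∑[ b < k ] (c b * f b) ≡ ∑[ b < k ] (c b * g b) + ∑[ b < k ] (c b * h b)
∑-weighted-+ k c f g h f≡g+h = trans
  (sum-cong-≗ {k} (λ b → trans (cong (c b *_) (f≡g+h b)) (*-distribˡ-+ (c b) (g b) (h b))))
  (∑-distrib-+ (λ b → c b * g b) (λ b → c b * h b))

<ᵇ-suc : ∀ x y → (x <ᵇ suc y) ≡ (x ≤ᵇ y)
<ᵇ-suc zero    y = refl
<ᵇ-suc (suc x) y = refl

∑-≤ᵇ-split : ∀ k (a : Fin k) (f : Fin k → ℕ) →
  ∑[ b < k ] (𝟙 (toℕ a ≤ᵇ toℕ b) * f b) ≡ ∑[ b < k ] (𝟙 (toℕ a <ᵇ toℕ b) * f b) + f a
∑-≤ᵇ-split (suc k) zero    f = trans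
  (cong (λ c → c + ∑[ b < k ] (f (suc b) + 0)) (+-identityʳ (f zero)))
  (+-comm (f zero) _)
∑-≤ᵇ-split (suc k) (suc a) f = trans
  (sum-cong-≗ {k} (λ b → cong (λ c → 𝟙 c * f (suc b)) (<ᵇ-suc (toℕ a) (toℕ b))))
  (∑-≤ᵇ-split k a (f ∘ suc))

sumSeqs : (k j : ℕ) → (List (Fin k) → ℕ) → ℕ
sumSeqs k zero    G = G []
sumSeqs k (suc j) G = ∑[ x < k ] sumSeqs k j (λ t → G (x ∷ t))

module _ {k : ℕ} where

  sumSeqs-cong-local : ∀ j {G H : List (Fin k) → ℕ} →
    (∀ t → length t ≡ j → G t ≡ H t) → sumSeqs k j G ≡ sumSeqs k j H
  sumSeqs-cong-local zero    G≡H = G≡H [] refl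
  sumSeqs-cong-local (suc j) G≡H =
    sum-cong-≗ {k} (λ x → sumSeqs-cong-local j (λ t ∣t∣≡j → G≡H (x ∷ t) (cong suc ∣t∣≡j)))

  sumSeqs-cong : ∀ j {G H : List (Fin k) → ℕ} → G ≗ H → sumSeqs k j G ≡ sumSeqs k j H
  sumSeqs-cong j G≗H = sumSeqs-cong-local j (λ t _ → G≗H t)

  sumSeqs-distrib-+ : ∀ j (G H : List (Fin k) → ℕ) →
    sumSeqs k j (λ t → G t + H t) ≡ sumSeqs k j G + sumSeqs k j H
  sumSeqs-distrib-+ zero    G H = refl
  sumSeqs-distrib-+ (suc j) G H = trans
    (sum-cong-≗ {k} (λ x → sumSeqs-distrib-+ j _ _))
    (∑-distrib-+ (λ x → sumSeqs k j (λ t → G (x ∷ t))) (λ x → sumSeqs k j (λ t → H (x ∷ t))))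

  *-distribˡ-sumSeqs : ∀ j c (G : List (Fin k) → ℕ) →
    c * sumSeqs k j G ≡ sumSeqs k j (λ t → c * G t)
  *-distribˡ-sumSeqs zero    c G = refl
  *-distribˡ-sumSeqs (suc j) c G = trans
    (*-distribˡ-sum c (λ x → sumSeqs k j (λ t → G (x ∷ t))))
    (sum-cong-≗ {k} (λ x → *-distribˡ-sumSeqs j c _))

  sumSeqs-zero : ∀ j → sumSeqs k j (λ _ → 0) ≡ 0
  sumSeqs-zero zero    = refl
  sumSeqs-zero (suc j) = trans (sum-cong-≗ {k} (λ _ → sumSeqs-zero j)) (∑-zero k)

  sumSeqs-permute : ∀ j (G : List (Fin k) → ℕ) (π : Permutation k k) →
    sumSeqs k j (G ∘ map (π ⟨$⟩ʳ_)) ≡ sumSeqs k j G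
  sumSeqs-permute zero    G π = refl
  sumSeqs-permute (suc j) G π = trans
    (sum-cong-≗ {k} (λ x → sumSeqs-permute j (λ t → G ((π ⟨$⟩ʳ x) ∷ t)) π))
    (sym (∑-permute (λ y → sumSeqs k j (λ t → G (y ∷ t))) π))

sumSeqs-avoiding-zero : ∀ k j (G : List (Fin (suc k)) → ℕ) →
  sumSeqs (suc k) j (λ t → 𝟙 (notIn zero t) * G t) ≡ sumSeqs k j (G ∘ map suc)
sumSeqs-avoiding-zero k zero    G = +-identityʳ (G [])
sumSeqs-avoiding-zero k (suc j) G = cong₂ _+_
  (sumSeqs-zero j)
  (sum-cong-≗ {k} (λ y → sumSeqs-avoiding-zero k j (λ t → G (suc y ∷ t))))

sum-tabulate : ∀ {n} (f : Fin n → ℕ) → sum (tabulate f) ≡ ∑[ i < n ] f i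
sum-tabulate {zero}  f = refl
sum-tabulate {suc n} f = cong (f zero +_) (sum-tabulate (f ∘ suc))

sum-map-allFin : ∀ {k} (f : Fin k → ℕ) → sum (map f (allFin k)) ≡ ∑[ i < k ] f i
sum-map-allFin f = trans (cong sum (map-tabulate (λ i → i) f)) (sum-tabulate f)

sum-map-concatMap : ∀ {A B : Set} (G : B → ℕ) (f : A → List B) xs →
  sum (map G (concatMap f xs)) ≡ sum (map (λ x → sum (map G (f x))) xs)
sum-map-concatMap G f []       = refl
sum-map-concatMap G f (x ∷ xs) = begin
  sum (map G (f x ++ concatMap f xs))                         ≡⟨ cong sum (map-++ G (f x) _) ⟩
  sum (map G (f x) ++ map G (concatMap f xs))                 ≡⟨ sum-++ (map G (f x)) _ ⟩
  sum (map G (f x)) + sum (map G (concatMap f xs))            ≡⟨ cong (_ +_) (sum-map-concatMap G f xs) ⟩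
  sum (map G (f x)) + sum (map (λ x → sum (map G (f x))) xs)  ∎
  where open ≡-Reasoning

sum-map-allSeqs : ∀ k j (G : List (Fin k) → ℕ) → sum (map G (allSeqs k j)) ≡ sumSeqs k j G
sum-map-allSeqs k zero    G = +-identityʳ (G [])
sum-map-allSeqs k (suc j) G = begin
  sum (map G (concatMap (λ x → map (x ∷_) (allSeqs k j)) (allFin k)))
    ≡⟨ sum-map-concatMap G _ (allFin k) ⟩
  sum (map (λ x → sum (map G (map (x ∷_) (allSeqs k j)))) (allFin k))
    ≡⟨ sum-map-allFin (λ x → sum (map G (map (x ∷_) (allSeqs k j)))) ⟩
  ∑[ x < k ] sum (map G (map (x ∷_) (allSeqs k j)))
    ≡⟨ sum-cong-≗ {k} (λ x → trans (cong sum (sym (map-∘ {g = G} {f = x ∷_} (allSeqs k j))))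
                                  (sum-map-allSeqs k j (λ t → G (x ∷ t)))) ⟩
  ∑[ x < k ] sumSeqs k j (λ t → G (x ∷ t)) ∎
  where open ≡-Reasoning

sum-map-filter : ∀ {A : Set} (p : A → Bool) (f : A → ℕ) xs →
  sum (map f (filter (T? ∘ p) xs)) ≡ sum (map (λ x → 𝟙 (p x) * f x) xs)
sum-map-filter p f []       = refl
sum-map-filter p f (x ∷ xs) with p x
... | true  = cong₂ _+_ (sym (+-identityʳ (f x))) (sum-map-filter p f xs)
... | false = sum-map-filter p f xs

count≡sum-map-𝟙 : ∀ {A : Set} (p : A → Bool) xs → count p xs ≡ sum (map (𝟙 ∘ p) xs)
count≡sum-map-𝟙 p []       = refl
count≡sum-map-𝟙 p (x ∷ xs) = cong (𝟙 (p x) +_) (count≡sum-map-𝟙 p xs)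

toℕ-≡ᵇ-refl : ∀ {k} (x : Fin k) → (toℕ x ≡ᵇ toℕ x) ≡ true
toℕ-≡ᵇ-refl x = dec-true (toℕ x ℕ.≟ toℕ x) refl

toℕ-≡ᵇ-≢ : ∀ {k} {x y : Fin k} → x ≢ y → (toℕ x ≡ᵇ toℕ y) ≡ false
toℕ-≡ᵇ-≢ {x = x} {y} x≢y = dec-false (toℕ x ℕ.≟ toℕ y) (x≢y ∘ toℕ-injective)

module _ {k l} {f : Fin k → Fin l} (f-injective : Injective _≡_ _≡_ f) where

  toℕ-≡ᵇ-injective : ∀ x y → (toℕ (f x) ≡ᵇ toℕ (f y)) ≡ (toℕ x ≡ᵇ toℕ y)
  toℕ-≡ᵇ-injective x y with x Fin.≟ y
  ... | yes refl = trans (toℕ-≡ᵇ-refl (f x)) (sym (toℕ-≡ᵇ-refl x))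
  ... | no x≢y   = trans (toℕ-≡ᵇ-≢ (x≢y ∘ f-injective)) (sym (toℕ-≡ᵇ-≢ x≢y))

  notIn-map : ∀ x t → notIn (f x) (map f t) ≡ notIn x t
  notIn-map x []      = refl
  notIn-map x (y ∷ t) = cong₂ (λ b c → not b ∧ c) (toℕ-≡ᵇ-injective x y) (notIn-map x t)

  distinct-map : ∀ t → distinct (map f t) ≡ distinct t
  distinct-map []      = refl
  distinct-map (x ∷ t) = cong₂ _∧_ (notIn-map x t) (distinct-map t)

permutation-injective : ∀ {k} (π : Permutation k k) → Injective _≡_ _≡_ (π ⟨$⟩ʳ_)
permutation-injective π πx≡πy =
  trans (sym (inverseˡ π)) (trans (cong (π ⟨$⟩ˡ_) πx≡πy) (inverseˡ π))

notIn-zero-map-suc : ∀ {k} (t : List (Fin k)) → notIn zero (map suc t) ≡ true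
notIn-zero-map-suc []      = refl
notIn-zero-map-suc (x ∷ t) = notIn-zero-map-suc t

notIn⇒≢lookup : ∀ {k} (x : Fin k) t i → notIn x t ≡ true → x ≢ lookup t i
notIn⇒≢lookup x (y ∷ t) zero    x∉t refl rewrite toℕ-≡ᵇ-refl y with () ← x∉t
notIn⇒≢lookup x (y ∷ t) (suc i) x∉t = notIn⇒≢lookup x t i (∧-conicalʳ _ (notIn x t) x∉t)

distinct⇒lookup-injective : ∀ {k} (t : List (Fin k)) → distinct t ≡ true →
  Injective _≡_ _≡_ (lookup t)
distinct⇒lookup-injective (x ∷ t) d {zero}  {zero}  _ = refl
distinct⇒lookup-injective (x ∷ t) d {zero}  {suc j} e =
  contradiction e (notIn⇒≢lookup x t j (∧-conicalˡ _ (distinct t) d))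
distinct⇒lookup-injective (x ∷ t) d {suc i} {zero}  e =
  contradiction (sym e) (notIn⇒≢lookup x t i (∧-conicalˡ _ (distinct t) d))
distinct⇒lookup-injective (x ∷ t) d {suc i} {suc j} e =
  cong suc (distinct⇒lookup-injective t (∧-conicalʳ (notIn x t) _ d) e)

distinct-long : ∀ {k} (t : List (Fin k)) → k < length t → distinct t ≡ false
distinct-long t k<∣t∣ with distinct t in d
... | false = refl
... | true  = contradiction (injective⇒≤ (distinct⇒lookup-injective t d)) (<⇒≱ k<∣t∣)

sumDistinct : (k j : ℕ) → (List (Fin k) → ℕ) → ℕ
sumDistinct k j F = sumSeqs k j (λ t → 𝟙 (distinct t) * F t)

sumDistinct-long : ∀ k j F → k < j → sumDistinct k j F ≡ 0
sumDistinct-long k j F k<j = trans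
  (sumSeqs-cong-local j λ t ∣t∣≡j →
    cong (λ b → 𝟙 b * F t) (distinct-long t (subst (k <_) (sym ∣t∣≡j) k<j)))
  (sumSeqs-zero j)

sumDistinct-split : ∀ k j (p : List (Fin k) → Bool) F → sumDistinct k j F ≡
  sumDistinct k j (λ t → 𝟙 (p t) * F t) + sumDistinct k j (λ t → 𝟙 (not (p t)) * F t)
sumDistinct-split k j p F = trans
  (sumSeqs-cong j λ t →
    trans (cong (𝟙 (distinct t) *_) (𝟙-split (p t) (F t))) (*-distribˡ-+ (𝟙 (distinct t)) _ _))
  (sumSeqs-distrib-+ j _ _)

hasZero : ∀ {k} → List (Fin (suc k)) → Bool
hasZero t = not (notIn zero t)

sumDistinct-hasZero : ∀ k F →
  sumDistinct (suc k) (suc k) F ≡ sumDistinct (suc k) (suc k) (λ t → 𝟙 (hasZero t) * F t)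
sumDistinct-hasZero k F = begin
  sumDistinct (suc k) (suc k) F
    ≡⟨ sumDistinct-split (suc k) (suc k) hasZero F ⟩
  withZero + sumDistinct (suc k) (suc k) (λ t → 𝟙 (not (hasZero t)) * F t)
    ≡⟨ cong (withZero +_) (sumSeqs-cong (suc k) rearrange) ⟩
  withZero + sumSeqs (suc k) (suc k) (λ t → 𝟙 (notIn zero t) * (𝟙 (distinct t) * F t))
    ≡⟨ cong (withZero +_) (sumSeqs-avoiding-zero k (suc k) (λ t → 𝟙 (distinct t) * F t)) ⟩
  withZero + sumSeqs k (suc k) (λ t → 𝟙 (distinct (map suc t)) * F (map suc t))
    ≡⟨ cong (withZero +_) (sumSeqs-cong (suc k) λ t →
         cong (λ b → 𝟙 b * F (map suc t)) (distinct-map Finₚ.suc-injective t)) ⟩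
  withZero + sumDistinct k (suc k) (F ∘ map suc)
    ≡⟨ cong (withZero +_) (sumDistinct-long k (suc k) (F ∘ map suc) (n<1+n k)) ⟩
  withZero + 0
    ≡⟨ +-identityʳ withZero ⟩
  withZero ∎
  where
  open ≡-Reasoning
  withZero : ℕ
  withZero = sumDistinct (suc k) (suc k) (λ t → 𝟙 (hasZero t) * F t)
  rearrange : ∀ t → 𝟙 (distinct t) * (𝟙 (not (hasZero t)) * F t) ≡ 𝟙 (notIn zero t) * (𝟙 (distinct t) * F t)
  rearrange t = trans (x∙yz≈y∙xz (𝟙 (distinct t)) (𝟙 (not (hasZero t))) (F t))
                      (cong (λ b → 𝟙 b * (𝟙 (distinct t) * F t)) (not-involutive (notIn zero t)))

sumSeqs-distinct-avoiding : ∀ k j (x : Fin (suc k)) →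
  sumSeqs (suc k) j (λ t → 𝟙 (notIn x t ∧ distinct t)) ≡ sumSeqs k j (𝟙 ∘ distinct)
sumSeqs-distinct-avoiding k j x = begin
  sumSeqs (suc k) j (λ t → 𝟙 (notIn x t ∧ distinct t))
    ≡⟨ sumSeqs-permute j (λ t → 𝟙 (notIn x t ∧ distinct t)) π ⟨
  sumSeqs (suc k) j (λ t → 𝟙 (notIn x (map (π ⟨$⟩ʳ_) t) ∧ distinct (map (π ⟨$⟩ʳ_) t)))
    ≡⟨ sumSeqs-cong j (λ t → cong₂ (λ a b → 𝟙 (a ∧ b))
         (notIn-map π-injective zero t) (distinct-map π-injective t)) ⟩
  sumSeqs (suc k) j (λ t → 𝟙 (notIn zero t ∧ distinct t))
    ≡⟨ sumSeqs-cong j (λ t → 𝟙-∧ (notIn zero t) (distinct t)) ⟩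
  sumSeqs (suc k) j (λ t → 𝟙 (notIn zero t) * 𝟙 (distinct t))
    ≡⟨ sumSeqs-avoiding-zero k j (𝟙 ∘ distinct) ⟩
  sumSeqs k j (𝟙 ∘ distinct ∘ map suc)
    ≡⟨ sumSeqs-cong j (cong 𝟙 ∘ distinct-map Finₚ.suc-injective) ⟩
  sumSeqs k j (𝟙 ∘ distinct) ∎
  where
  open ≡-Reasoning
  π : Permutation (suc k) (suc k)
  π = transpose zero x
  π-injective : Injective _≡_ _≡_ (π ⟨$⟩ʳ_)
  π-injective = permutation-injective π

sumSeqs-distinct : ∀ n → sumSeqs n n (𝟙 ∘ distinct) ≡ n !
sumSeqs-distinct zero    = refl
sumSeqs-distinct (suc n) = begin
  ∑[ x < suc n ] sumSeqs (suc n) n (λ t → 𝟙 (notIn x t ∧ distinct t))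
    ≡⟨ sum-cong-≗ {suc n} (sumSeqs-distinct-avoiding n n) ⟩
  ∑[ x < suc n ] sumSeqs n n (𝟙 ∘ distinct)
    ≡⟨ ∑-const (suc n) _ ⟩
  suc n * sumSeqs n n (𝟙 ∘ distinct)
    ≡⟨ cong (suc n *_) (sumSeqs-distinct n) ⟩
  suc n ! ∎
  where open ≡-Reasoning

-- The Redei–Berge polynomial as a sum over listings

ascent : ∀ {m} → Bool → Fin m → Fin m → Bool
ascent strict a b = if strict then toℕ a <ᵇ toℕ b else toℕ a ≤ᵇ toℕ b

compatibleCount : (X : Digraph) → ℕ → List (Fin (size X)) → ℕ
compatibleCount X m τ = sumSeqs m (length τ) (𝟙 ∘ compatible X τ)

redeiBerge≡sumDistinct : ∀ X m →
  redeiBerge X m ≡ sumDistinct (size X) (size X) (compatibleCount X m)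
redeiBerge≡sumDistinct X m = begin
  sum (map (F-spec X m) (filter (T? ∘ distinct) (allSeqs n n)))
    ≡⟨ sum-map-filter distinct (F-spec X m) (allSeqs n n) ⟩
  sum (map (λ τ → 𝟙 (distinct τ) * F-spec X m τ) (allSeqs n n))
    ≡⟨ sum-map-allSeqs n n _ ⟩
  sumDistinct n n (F-spec X m)
    ≡⟨ sumSeqs-cong-local n (λ τ ∣τ∣≡n →
         cong (𝟙 (distinct τ) *_) (F-spec≡compatibleCount τ ∣τ∣≡n)) ⟩
  sumDistinct n n (compatibleCount X m) ∎
  where
  open ≡-Reasoning
  n : ℕ
  n = size X
  F-spec≡compatibleCount : ∀ τ → length τ ≡ n → F-spec X m τ ≡ compatibleCount X m τ
  F-spec≡compatibleCount τ ∣τ∣≡n = begin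
    count (compatible X τ) (allSeqs m n)          ≡⟨ count≡sum-map-𝟙 (compatible X τ) (allSeqs m n) ⟩
    sum (map (𝟙 ∘ compatible X τ) (allSeqs m n))  ≡⟨ sum-map-allSeqs m n (𝟙 ∘ compatible X τ) ⟩
    sumSeqs m n (𝟙 ∘ compatible X τ)              ≡⟨ cong (λ j → sumSeqs m j (𝟙 ∘ compatible X τ)) ∣τ∣≡n ⟨
    compatibleCount X m τ                         ∎

digraph : (n : ℕ) → (Fin n → Fin n → Bool) → Digraph
digraph n e = record { size = n ; edge = e }

linked-universal : ∀ {A : Set} {R : A → A → Set} → (∀ a b → R a b) → ∀ xs → Linked R xs
linked-universal R-all []           = []
linked-universal R-all (a ∷ [])     = [-]
linked-universal R-all (a ∷ b ∷ xs) = R-all a b ∷ linked-universal R-all (b ∷ xs)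

module _ (X Y : Digraph) (f : Fin (size X) → Fin (size Y)) {m : ℕ} where

  compatible-map : ∀ τ (s : List (Fin m)) →
    Linked (λ a b → edge Y (f a) (f b) ≡ edge X a b) τ →
    compatible Y (map f τ) s ≡ compatible X τ s
  compatible-map (a ∷ b ∷ τ) (x ∷ y ∷ s) (eab ∷ es) =
    cong₂ (λ e c → ascent e x y ∧ c) eab (compatible-map (b ∷ τ) (y ∷ s) es)
  compatible-map []          s        _ = refl
  compatible-map (a ∷ [])    s        _ = refl
  compatible-map (a ∷ b ∷ τ) []       _ = refl
  compatible-map (a ∷ b ∷ τ) (x ∷ []) _ = refl

  compatibleCount-map : ∀ τ → Linked (λ a b → edge Y (f a) (f b) ≡ edge X a b) τ →
    compatibleCount Y m (map f τ) ≡ compatibleCount X m τ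
  compatibleCount-map τ es = trans
    (cong (λ j → sumSeqs m j (𝟙 ∘ compatible Y (map f τ))) (length-map f τ))
    (sumSeqs-cong (length τ) (λ s → cong 𝟙 (compatible-map τ s es)))

redeiBerge-relabel : ∀ {n} (e e′ : Fin n → Fin n → Bool) (π : Permutation n n) →
  (∀ a b → e′ (π ⟨$⟩ʳ a) (π ⟨$⟩ʳ b) ≡ e a b) →
  ∀ m → redeiBerge (digraph n e) m ≡ redeiBerge (digraph n e′) m
redeiBerge-relabel {n} e e′ π π-preserves m = begin
  redeiBerge X m
    ≡⟨ redeiBerge≡sumDistinct X m ⟩
  sumDistinct n n (compatibleCount X m)
    ≡⟨ sumSeqs-cong n (λ τ → cong₂ _*_
         (cong 𝟙 (distinct-map (permutation-injective π) τ))
         (compatibleCount-map X Y (π ⟨$⟩ʳ_) τ (linked-universal π-preserves τ))) ⟨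
  sumSeqs n n (G ∘ map (π ⟨$⟩ʳ_))
    ≡⟨ sumSeqs-permute n G π ⟩
  sumDistinct n n (compatibleCount Y m)
    ≡⟨ redeiBerge≡sumDistinct Y m ⟨
  redeiBerge Y m ∎
  where
  open ≡-Reasoning
  X Y : Digraph
  X = digraph n e
  Y = digraph n e′
  G : List (Fin n) → ℕ
  G τ = 𝟙 (distinct τ) * compatibleCount Y m τ

-- Edgeless digraphs

weaklyIncreasing : ∀ {m} → List (Fin m) → Bool
weaklyIncreasing (x ∷ y ∷ s) = (toℕ x ≤ᵇ toℕ y) ∧ weaklyIncreasing (y ∷ s)
weaklyIncreasing _           = true

multichoose : ℕ → ℕ → ℕ
multichoose m n = sumSeqs m n (𝟙 ∘ weaklyIncreasing)

weaklyIncreasing-zero∷ : ∀ {m} (t : List (Fin (suc m))) →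
  weaklyIncreasing (zero ∷ t) ≡ weaklyIncreasing t
weaklyIncreasing-zero∷ []      = refl
weaklyIncreasing-zero∷ (y ∷ t) = refl

weaklyIncreasing-map-suc : ∀ {m} (t : List (Fin m)) →
  weaklyIncreasing (map suc t) ≡ weaklyIncreasing t
weaklyIncreasing-map-suc []          = refl
weaklyIncreasing-map-suc (x ∷ [])    = refl
weaklyIncreasing-map-suc (x ∷ y ∷ t) =
  cong₂ _∧_ (<ᵇ-suc (toℕ x) (toℕ y)) (weaklyIncreasing-map-suc (y ∷ t))

weaklyIncreasing-suc∷-avoids-zero : ∀ {m} (y : Fin m) t →
  𝟙 (weaklyIncreasing (suc y ∷ t)) ≡ 𝟙 (notIn zero t) * 𝟙 (weaklyIncreasing (suc y ∷ t))
weaklyIncreasing-suc∷-avoids-zero y []          = refl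
weaklyIncreasing-suc∷-avoids-zero y (zero ∷ t)  = refl
weaklyIncreasing-suc∷-avoids-zero y (suc z ∷ t) with toℕ y <ᵇ suc (toℕ z)
... | false = sym (*-zeroʳ (𝟙 (notIn zero t)))
... | true  = weaklyIncreasing-suc∷-avoids-zero z t

multichoose-suc : ∀ m n →
  multichoose (suc m) (suc n) ≡ multichoose (suc m) n + multichoose m (suc n)
multichoose-suc m n = cong₂ _+_
  (sumSeqs-cong n (cong 𝟙 ∘ weaklyIncreasing-zero∷))
  (sum-cong-≗ {m} λ y → begin
    sumSeqs (suc m) n (λ t → 𝟙 (weaklyIncreasing (suc y ∷ t)))
      ≡⟨ sumSeqs-cong n (weaklyIncreasing-suc∷-avoids-zero y) ⟩
    sumSeqs (suc m) n (λ t → 𝟙 (notIn zero t) * 𝟙 (weaklyIncreasing (suc y ∷ t)))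
      ≡⟨ sumSeqs-avoiding-zero m n (λ t → 𝟙 (weaklyIncreasing (suc y ∷ t))) ⟩
    sumSeqs m n (λ t → 𝟙 (weaklyIncreasing (map suc (y ∷ t))))
      ≡⟨ sumSeqs-cong n (λ t → cong 𝟙 (weaklyIncreasing-map-suc (y ∷ t))) ⟩
    sumSeqs m n (λ t → 𝟙 (weaklyIncreasing (y ∷ t))) ∎)
  where open ≡-Reasoning

rising-suc : ∀ m n → rising m (suc n) ≡ m * rising (suc m) n
rising-suc m zero    = solve 1 (λ m → con 1 :* (m :+ con 0) := m :* con 1) refl m
  where open +-*-Solver
rising-suc m (suc n) = begin
  rising m (suc n) * (m + suc n)        ≡⟨ cong (_* (m + suc n)) (rising-suc m n) ⟩
  m * rising (suc m) n * (m + suc n)    ≡⟨ *-assoc m _ _ ⟩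
  m * (rising (suc m) n * (m + suc n))  ≡⟨ cong (λ z → m * (rising (suc m) n * z)) (+-suc m n) ⟩
  m * rising (suc m) (suc n)            ∎
  where open ≡-Reasoning

multichoose*!≡rising : ∀ m n → multichoose m n * n ! ≡ rising m n
multichoose*!≡rising m       zero    = refl
multichoose*!≡rising zero    (suc n) = sym (rising-suc 0 n)
multichoose*!≡rising (suc m) (suc n) = begin
  multichoose (suc m) (suc n) * suc n !
    ≡⟨ cong (_* suc n !) (multichoose-suc m n) ⟩
  (multichoose (suc m) n + multichoose m (suc n)) * suc n !
    ≡⟨ *-distribʳ-+ (suc n !) (multichoose (suc m) n) _ ⟩
  multichoose (suc m) n * (suc n * n !) + multichoose m (suc n) * suc n !
    ≡⟨ cong₂ _+_ (x∙yz≈y∙xz (multichoose (suc m) n) (suc n) (n !)) (multichoose*!≡rising m (suc n)) ⟩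
  suc n * (multichoose (suc m) n * n !) + rising m (suc n)
    ≡⟨ cong₂ _+_ (cong (suc n *_) (multichoose*!≡rising (suc m) n)) (rising-suc m n) ⟩
  suc n * rising (suc m) n + m * rising (suc m) n
    ≡⟨ solve 3 (λ n m r → (con 1 :+ n) :* r :+ m :* r := r :* (con 1 :+ (m :+ n))) refl n m (rising (suc m) n) ⟩
  rising (suc m) (suc n) ∎
  where
  open ≡-Reasoning
  open +-*-Solver

module _ (X : Digraph) (edgeless : ∀ a b → edge X a b ≡ false) {m : ℕ} where

  compatible-edgeless : ∀ τ (s : List (Fin m)) → length s ≡ length τ →
    compatible X τ s ≡ weaklyIncreasing s
  compatible-edgeless (a ∷ b ∷ τ) (x ∷ y ∷ s) ∣s∣≡∣τ∣ = cong₂ (λ e c → ascent e x y ∧ c)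
    (edgeless a b) (compatible-edgeless (b ∷ τ) (y ∷ s) (suc-injective ∣s∣≡∣τ∣))
  compatible-edgeless []       []       _ = refl
  compatible-edgeless (a ∷ []) (x ∷ []) _ = refl

  compatibleCount-edgeless : ∀ τ → compatibleCount X m τ ≡ multichoose m (length τ)
  compatibleCount-edgeless τ =
    sumSeqs-cong-local (length τ) (λ s ∣s∣≡∣τ∣ → cong 𝟙 (compatible-edgeless τ s ∣s∣≡∣τ∣))

  redeiBerge-edgeless : redeiBerge X m ≡ rising m (size X)
  redeiBerge-edgeless = begin
    redeiBerge X m                                         ≡⟨ redeiBerge≡sumDistinct X m ⟩
    sumDistinct n n (compatibleCount X m)                  ≡⟨ sumSeqs-cong-local n summand ⟩
    sumSeqs n n (λ τ → multichoose m n * 𝟙 (distinct τ))   ≡⟨ *-distribˡ-sumSeqs n (multichoose m n) (𝟙 ∘ distinct) ⟨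
    multichoose m n * sumSeqs n n (𝟙 ∘ distinct)           ≡⟨ cong (multichoose m n *_) (sumSeqs-distinct n) ⟩
    multichoose m n * n !                                  ≡⟨ multichoose*!≡rising m n ⟩
    rising m n                                             ∎
    where
    open ≡-Reasoning
    n : ℕ
    n = size X
    summand : ∀ τ → length τ ≡ n →
      𝟙 (distinct τ) * compatibleCount X m τ ≡ multichoose m n * 𝟙 (distinct τ)
    summand τ ∣τ∣≡n = trans
      (cong (𝟙 (distinct τ) *_) (trans (compatibleCount-edgeless τ) (cong (multichoose m) ∣τ∣≡n)))
      (*-comm (𝟙 (distinct τ)) (multichoose m n))

-- Deletion–contraction for path forests

module _ {k : ℕ} where

  zeroThenOne : List (Fin (suc (suc k))) → Bool
  zeroThenOne []                    = false
  zeroThenOne (zero ∷ suc zero ∷ t) = true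
  zeroThenOne (x ∷ t)               = zeroThenOne t

  -- Undoes the contraction of 0 → 1: vertex 0 becomes the pair 0, 1 and i + 1 becomes i + 2.
  expand : List (Fin (suc k)) → List (Fin (suc (suc k)))
  expand []          = []
  expand (zero ∷ t)  = zero ∷ suc zero ∷ expand t
  expand (suc x ∷ t) = suc (suc x) ∷ expand t

  zeroThenOne-avoiding : ∀ t → notIn zero t ≡ true → zeroThenOne t ≡ false
  zeroThenOne-avoiding []          _   = refl
  zeroThenOne-avoiding (suc x ∷ t) 0∉t = zeroThenOne-avoiding t 0∉t

  zeroThenOne⇒hasOne : ∀ t → zeroThenOne t ≡ true → notIn (suc zero) t ≡ false
  zeroThenOne⇒hasOne (zero ∷ suc zero ∷ t)    _  = refl
  zeroThenOne⇒hasOne (zero ∷ zero ∷ t)        z1 = zeroThenOne⇒hasOne (zero ∷ t) z1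
  zeroThenOne⇒hasOne (zero ∷ suc (suc y) ∷ t) z1 = zeroThenOne⇒hasOne (suc (suc y) ∷ t) z1
  zeroThenOne⇒hasOne (suc x ∷ t)              z1 =
    trans (cong (_ ∧_) (zeroThenOne⇒hasOne t z1)) (∧-zeroʳ _)

  expand-avoiding : ∀ t → notIn zero t ≡ true → expand t ≡ map suc t
  expand-avoiding []          _   = refl
  expand-avoiding (suc x ∷ t) 0∉t = cong (suc (suc x) ∷_) (expand-avoiding t 0∉t)

  notIn-expand : ∀ (w : Fin k) t → notIn (suc (suc w)) (expand t) ≡ notIn (suc w) t
  notIn-expand w []          = refl
  notIn-expand w (zero ∷ t)  = notIn-expand w t
  notIn-expand w (suc x ∷ t) = cong (_ ∧_) (notIn-expand w t)

  sumDistinct-zeroThenOne : ∀ j (F : List (Fin (suc (suc k))) → ℕ) →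
    sumDistinct (suc (suc k)) (suc j) (λ τ → 𝟙 (zeroThenOne τ) * F τ) ≡
    sumDistinct (suc k) j (λ t → 𝟙 (hasZero t) * F (expand t))
  sumDistinct-zeroThenOne zero    F = trans
    (sum-cong-≗ {suc (suc k)} {x = λ x → 𝟙 (distinct (x ∷ [])) * (𝟙 (zeroThenOne (x ∷ [])) * F (x ∷ []))}
                               {y = λ _ → 0} (λ { zero → refl ; (suc x) → refl }))
    (∑-zero (suc (suc k)))
  sumDistinct-zeroThenOne (suc j) F =
    cong₂ _+_ headZero (trans (cong (_+ largerHeads) headOne) (sum-cong-≗ {k} headLarger))
    where
    open ≡-Reasoning

    F₀₁ : List (Fin (suc (suc k))) → ℕ
    F₀₁ t = F (zero ∷ suc zero ∷ t)

    largerHeads : ℕ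
    largerHeads = ∑[ w < k ] sumSeqs (suc (suc k)) (suc j) λ t →
      𝟙 (notIn (suc (suc w)) t ∧ distinct t) * (𝟙 (zeroThenOne t) * F (suc (suc w) ∷ t))

    -- The entry after 0 must be 1: a second 0 breaks distinctness, and after any
    -- other entry the pair 0, 1 could only occur again with a repeated 0.
    headZero :
      sumSeqs (suc (suc k)) (suc j) (λ t → 𝟙 (distinct (zero ∷ t)) * (𝟙 (zeroThenOne (zero ∷ t)) * F (zero ∷ t)))
      ≡ sumSeqs (suc k) j (λ t → 𝟙 (notIn zero t ∧ distinct t) * (1 * F₀₁ (expand t)))
    headZero = begin
      sumSeqs (suc (suc k)) j (λ _ → 0) + (nextOne + ∑[ w < k ] sumSeqs (suc (suc k)) j λ t →
        𝟙 (notIn zero t ∧ distinct (suc (suc w) ∷ t)) * (𝟙 (zeroThenOne t) * F (zero ∷ suc (suc w) ∷ t)))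
        ≡⟨ cong₂ (λ a b → a + (nextOne + b)) (sumSeqs-zero j)
             (trans (sum-cong-≗ {k} (λ w → trans (sumSeqs-cong j (λ t → noFurtherPair t _ _)) (sumSeqs-zero j)))
                    (∑-zero k)) ⟩
      nextOne + 0
        ≡⟨ +-identityʳ nextOne ⟩
      nextOne
        ≡⟨ sumSeqs-cong j (λ t → 𝟙-∧-* (notIn zero t) _ _) ⟩
      sumSeqs (suc (suc k)) j (λ t → 𝟙 (notIn zero t) * (𝟙 (notIn (suc zero) t ∧ distinct t) * (1 * F₀₁ t)))
        ≡⟨ sumSeqs-avoiding-zero (suc k) j (λ t → 𝟙 (notIn (suc zero) t ∧ distinct t) * (1 * F₀₁ t)) ⟩
      sumSeqs (suc k) j (λ t → 𝟙 (notIn (suc zero) (map suc t) ∧ distinct (map suc t)) * (1 * F₀₁ (map suc t)))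
        ≡⟨ sumSeqs-cong j (λ t → cong₂ (λ a b → 𝟙 (a ∧ b) * (1 * F₀₁ (map suc t)))
             (notIn-map Finₚ.suc-injective zero t) (distinct-map Finₚ.suc-injective t)) ⟩
      sumSeqs (suc k) j (λ t → 𝟙 (notIn zero t ∧ distinct t) * (1 * F₀₁ (map suc t)))
        ≡⟨ sumSeqs-cong j (λ t → 𝟙-guard (notIn zero t ∧ distinct t) λ 0∉t →
             cong (λ u → 1 * F₀₁ u) (sym (expand-avoiding t (∧-conicalˡ _ (distinct t) 0∉t)))) ⟩
      sumSeqs (suc k) j (λ t → 𝟙 (notIn zero t ∧ distinct t) * (1 * F₀₁ (expand t))) ∎
      where
      nextOne : ℕ
      nextOne = sumSeqs (suc (suc k)) j λ t →
        𝟙 (notIn zero t ∧ (notIn (suc zero) t ∧ distinct t)) * (1 * F₀₁ t)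
      noFurtherPair : ∀ t d c → 𝟙 (notIn zero t ∧ d) * (𝟙 (zeroThenOne t) * c) ≡ 0
      noFurtherPair t d c with notIn zero t in 0∉t
      ... | false = refl
      ... | true rewrite zeroThenOne-avoiding t 0∉t = *-zeroʳ (𝟙 d)

    headOne : sumSeqs (suc (suc k)) (suc j)
                (λ t → 𝟙 (distinct (suc zero ∷ t)) * (𝟙 (zeroThenOne (suc zero ∷ t)) * F (suc zero ∷ t))) ≡ 0
    headOne = trans (sumSeqs-cong (suc j) vanishes) (sumSeqs-zero (suc j))
      where
      vanishes : ∀ t → 𝟙 (notIn (suc zero) t ∧ distinct t) * (𝟙 (zeroThenOne t) * F (suc zero ∷ t)) ≡ 0
      vanishes t with zeroThenOne t in z1
      ... | false = *-zeroʳ (𝟙 (notIn (suc zero) t ∧ distinct t))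
      ... | true rewrite zeroThenOne⇒hasOne t z1 = refl

    swapIndicators : ∀ a d z f → 𝟙 (a ∧ d) * (z * f) ≡ 𝟙 d * (z * (𝟙 a * f))
    swapIndicators a d z f = trans (cong (_* (z * f)) (𝟙-∧ a d))
      (solve 4 (λ a d z f → (a :* d) :* (z :* f) := d :* (z :* (a :* f))) refl (𝟙 a) (𝟙 d) z f)
      where open +-*-Solver

    headLarger : ∀ (w : Fin k) →
      sumSeqs (suc (suc k)) (suc j)
        (λ t → 𝟙 (notIn (suc (suc w)) t ∧ distinct t) * (𝟙 (zeroThenOne t) * F (suc (suc w) ∷ t)))
      ≡ sumSeqs (suc k) j (λ t → 𝟙 (notIn (suc w) t ∧ distinct t) * (𝟙 (hasZero t) * F (suc (suc w) ∷ expand t)))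
    headLarger w = begin
      sumSeqs (suc (suc k)) (suc j) (λ t → 𝟙 (notIn w₂ t ∧ distinct t) * (𝟙 (zeroThenOne t) * F (w₂ ∷ t)))
        ≡⟨ sumSeqs-cong (suc j) (λ t →
             swapIndicators (notIn w₂ t) (distinct t) (𝟙 (zeroThenOne t)) (F (w₂ ∷ t))) ⟩
      sumDistinct (suc (suc k)) (suc j) (λ t → 𝟙 (zeroThenOne t) * (𝟙 (notIn w₂ t) * F (w₂ ∷ t)))
        ≡⟨ sumDistinct-zeroThenOne j (λ t → 𝟙 (notIn w₂ t) * F (w₂ ∷ t)) ⟩
      sumDistinct (suc k) j (λ t → 𝟙 (hasZero t) * (𝟙 (notIn w₂ (expand t)) * F (w₂ ∷ expand t)))
        ≡⟨ sumSeqs-cong j (λ t → cong (λ b → 𝟙 (distinct t) * (𝟙 (hasZero t) * (𝟙 b * F (w₂ ∷ expand t))))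
                                      (notIn-expand w t)) ⟩
      sumDistinct (suc k) j (λ t → 𝟙 (hasZero t) * (𝟙 (notIn (suc w) t) * F (w₂ ∷ expand t)))
        ≡⟨ sumSeqs-cong j (λ t →
             swapIndicators (notIn (suc w) t) (distinct t) (𝟙 (hasZero t)) (F (w₂ ∷ expand t))) ⟨
      sumSeqs (suc k) j (λ t → 𝟙 (notIn (suc w) t ∧ distinct t) * (𝟙 (hasZero t) * F (w₂ ∷ expand t))) ∎
      where
      w₂ : Fin (suc (suc k))
      w₂ = suc (suc w)

pathGraph : (n : ℕ) → (ℕ → Bool) → Digraph
pathGraph n h = digraph n (λ a b → (toℕ b ≡ᵇ suc (toℕ a)) ∧ h (toℕ a))

withoutFirstEdge : (ℕ → Bool) → ℕ → Bool
withoutFirstEdge h zero    = false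
withoutFirstEdge h (suc a) = h (suc a)

countFrom : (X : Digraph) (m : ℕ) → Fin (size X) → List (Fin (size X)) → Fin m → ℕ
countFrom X m x r a = sumSeqs m (length r) (λ t → 𝟙 (compatible X (x ∷ r) (a ∷ t)))

countFrom-∷ : ∀ X m x y r a →
  countFrom X m x (y ∷ r) a ≡ ∑[ b < m ] (𝟙 (ascent (edge X x y) a b) * countFrom X m y r b)
countFrom-∷ X m x y r a = sum-cong-≗ {m} λ b → trans
  (sumSeqs-cong (length r) (λ t → 𝟙-∧ (ascent (edge X x y) a b) (compatible X (y ∷ r) (b ∷ t))))
  (sym (*-distribˡ-sumSeqs (length r) (𝟙 (ascent (edge X x y) a b)) (λ t → 𝟙 (compatible X (y ∷ r) (b ∷ t)))))

module DeletionContraction {k : ℕ} (h : ℕ → Bool) (h0 : h 0 ≡ true) (m : ℕ) where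

  X X∖e : Digraph
  X   = pathGraph (suc (suc k)) h
  X∖e = pathGraph (suc (suc k)) (withoutFirstEdge h)

  X/e : Digraph
  X/e = pathGraph (suc k) (h ∘ suc)

  deleted-edges-agree : ∀ τ → zeroThenOne τ ≡ false → Linked (λ a b → edge X∖e a b ≡ edge X a b) τ
  deleted-edges-agree []                       _  = []
  deleted-edges-agree (a ∷ [])                 _  = [-]
  deleted-edges-agree (zero ∷ zero ∷ τ)        z1 = refl ∷ deleted-edges-agree (zero ∷ τ) z1
  deleted-edges-agree (zero ∷ suc (suc b) ∷ τ) z1 = refl ∷ deleted-edges-agree (suc (suc b) ∷ τ) z1
  deleted-edges-agree (suc a ∷ b ∷ τ)          z1 = refl ∷ deleted-edges-agree (b ∷ τ) z1

  compatible-deleted : ∀ τ (s : List (Fin m)) → zeroThenOne τ ≡ false →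
    compatible X∖e τ s ≡ compatible X τ s
  compatible-deleted τ s z1 = trans
    (cong (λ σ → compatible X∖e σ s) (sym (map-id τ)))
    (compatible-map X X∖e (λ a → a) τ s (deleted-edges-agree τ z1))

  countFrom-contracted : ∀ x r (a : Fin m) → countFrom X m (suc x) (map suc r) a ≡ countFrom X/e m x r a
  countFrom-contracted x r a = trans
    (cong (λ j → sumSeqs m j (λ t → 𝟙 (compatible X (suc x ∷ map suc r) (a ∷ t)))) (length-map suc r))
    (sumSeqs-cong (length r) λ t →
      cong 𝟙 (compatible-map X/e X suc (x ∷ r) (a ∷ t) (linked-universal (λ _ _ → refl) (x ∷ r))))

  -- Without the edge 0 → 1 the values at 0 and 1 need only satisfy ≤ instead of <;
  -- the sequences with equal values there are those of the contraction.
  countFrom-zeroOne : ∀ r (a : Fin m) → notIn zero r ≡ true →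
    countFrom X∖e m zero (suc zero ∷ expand r) a ≡
    countFrom X m zero (suc zero ∷ expand r) a + countFrom X/e m zero r a
  countFrom-zeroOne r a 0∉r rewrite expand-avoiding r 0∉r = begin
    countFrom X∖e m zero (suc zero ∷ map suc r) a
      ≡⟨ countFrom-∷ X∖e m zero (suc zero) (map suc r) a ⟩
    ∑[ b < m ] (𝟙 (toℕ a ≤ᵇ toℕ b) * countFrom X∖e m (suc zero) (map suc r) b)
      ≡⟨ sum-cong-≗ {m} (λ b → cong (𝟙 (toℕ a ≤ᵇ toℕ b) *_) (sumSeqs-cong (length (map suc r)) λ t →
           cong 𝟙 (compatible-deleted (suc zero ∷ map suc r) (b ∷ t) 1∷r-avoids-pair))) ⟩
    ∑[ b < m ] (𝟙 (toℕ a ≤ᵇ toℕ b) * countFrom X m (suc zero) (map suc r) b)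
      ≡⟨ ∑-≤ᵇ-split m a (countFrom X m (suc zero) (map suc r)) ⟩
    ∑[ b < m ] (𝟙 (toℕ a <ᵇ toℕ b) * countFrom X m (suc zero) (map suc r) b) + countFrom X m (suc zero) (map suc r) a
      ≡⟨ cong₂ _+_ (sym (trans (countFrom-∷ X m zero (suc zero) (map suc r) a) (sum-cong-≗ {m} strict)))
                   (countFrom-contracted zero r a) ⟩
    countFrom X m zero (suc zero ∷ map suc r) a + countFrom X/e m zero r a ∎
    where
    open ≡-Reasoning
    1∷r-avoids-pair : zeroThenOne (map suc r) ≡ false
    1∷r-avoids-pair = zeroThenOne-avoiding (map suc r) (notIn-zero-map-suc r)
    strict : ∀ b → 𝟙 (ascent (h 0) a b) * countFrom X m (suc zero) (map suc r) b
                 ≡ 𝟙 (toℕ a <ᵇ toℕ b) * countFrom X m (suc zero) (map suc r) b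
    strict b rewrite h0 = refl

  countFrom-expand : ∀ (y : Fin k) r (a : Fin m) → distinct r ≡ true → hasZero r ≡ true →
    countFrom X∖e m (suc (suc y)) (expand r) a ≡
    countFrom X m (suc (suc y)) (expand r) a + countFrom X/e m (suc y) r a
  countFrom-expand y (zero ∷ r) a dist _ = trans
    (countFrom-∷ X∖e m (suc (suc y)) zero (suc zero ∷ expand r) a)
    (trans (∑-weighted-+ m (λ b → 𝟙 (ascent (edge X/e (suc y) zero) a b)) _
              (countFrom X m zero (suc zero ∷ expand r)) (countFrom X/e m zero r)
              (λ b → countFrom-zeroOne r b (∧-conicalˡ _ (distinct r) dist)))
           (sym (cong₂ _+_ (countFrom-∷ X m (suc (suc y)) zero (suc zero ∷ expand r) a)
                           (countFrom-∷ X/e m (suc y) zero r a))))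
  countFrom-expand y (suc z ∷ r) a dist hasZero-r = trans
    (countFrom-∷ X∖e m (suc (suc y)) (suc (suc z)) (expand r) a)
    (trans (∑-weighted-+ m (λ b → 𝟙 (ascent (edge X/e (suc y) (suc z)) a b)) _
              (countFrom X m (suc (suc z)) (expand r)) (countFrom X/e m (suc z) r)
              (λ b → countFrom-expand z r b (∧-conicalʳ (notIn (suc z) r) _ dist) hasZero-r))
           (sym (cong₂ _+_ (countFrom-∷ X m (suc (suc y)) (suc (suc z)) (expand r) a)
                           (countFrom-∷ X/e m (suc y) (suc z) r a))))

  compatibleCount-expand : ∀ τ → distinct τ ≡ true → hasZero τ ≡ true →
    compatibleCount X∖e m (expand τ) ≡ compatibleCount X m (expand τ) + compatibleCount X/e m τ
  compatibleCount-expand (zero ∷ r) dist _ = trans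
    (sum-cong-≗ {m} (λ a → countFrom-zeroOne r a (∧-conicalˡ _ (distinct r) dist)))
    (∑-distrib-+ (countFrom X m zero (suc zero ∷ expand r)) (countFrom X/e m zero r))
  compatibleCount-expand (suc y ∷ r) dist hasZero-r = trans
    (sum-cong-≗ {m} (λ a → countFrom-expand y r a (∧-conicalʳ (notIn (suc y) r) _ dist) hasZero-r))
    (∑-distrib-+ (countFrom X m (suc (suc y)) (expand r)) (countFrom X/e m (suc y) r))

  private
    n : ℕ
    n = suc (suc k)

  sumDistinct-zeroThenOne-deleted :
    sumDistinct n n (λ τ → 𝟙 (zeroThenOne τ) * compatibleCount X∖e m τ) ≡
    sumDistinct n n (λ τ → 𝟙 (zeroThenOne τ) * compatibleCount X m τ)
      + sumDistinct (suc k) (suc k) (compatibleCount X/e m)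
  sumDistinct-zeroThenOne-deleted = begin
    sumDistinct n n (λ τ → 𝟙 (zeroThenOne τ) * compatibleCount X∖e m τ)
      ≡⟨ sumDistinct-zeroThenOne (suc k) (compatibleCount X∖e m) ⟩
    sumDistinct (suc k) (suc k) (λ t → 𝟙 (hasZero t) * compatibleCount X∖e m (expand t))
      ≡⟨ sumSeqs-cong (suc k) split-expand ⟩
    sumSeqs (suc k) (suc k) (λ t → viaX t + viaX/e t)
      ≡⟨ sumSeqs-distrib-+ (suc k) viaX viaX/e ⟩
    sumSeqs (suc k) (suc k) viaX + sumSeqs (suc k) (suc k) viaX/e
      ≡⟨ cong₂ _+_ (sumDistinct-zeroThenOne (suc k) (compatibleCount X m))
                   (sumDistinct-hasZero k (compatibleCount X/e m)) ⟨
    sumDistinct n n (λ τ → 𝟙 (zeroThenOne τ) * compatibleCount X m τ)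
      + sumDistinct (suc k) (suc k) (compatibleCount X/e m) ∎
    where
    open ≡-Reasoning
    viaX viaX/e : List (Fin (suc k)) → ℕ
    viaX   t = 𝟙 (distinct t) * (𝟙 (hasZero t) * compatibleCount X m (expand t))
    viaX/e t = 𝟙 (distinct t) * (𝟙 (hasZero t) * compatibleCount X/e m t)
    split-expand : ∀ t → 𝟙 (distinct t) * (𝟙 (hasZero t) * compatibleCount X∖e m (expand t)) ≡ viaX t + viaX/e t
    split-expand t = begin
      𝟙 (distinct t) * (𝟙 (hasZero t) * compatibleCount X∖e m (expand t))
        ≡⟨ 𝟙-guard (distinct t) (λ dist → 𝟙-guard (hasZero t) (compatibleCount-expand t dist)) ⟩
      𝟙 (distinct t) * (𝟙 (hasZero t) * (compatibleCount X m (expand t) + compatibleCount X/e m t))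
        ≡⟨ cong (𝟙 (distinct t) *_) (*-distribˡ-+ (𝟙 (hasZero t)) _ _) ⟩
      𝟙 (distinct t) * (𝟙 (hasZero t) * compatibleCount X m (expand t) + 𝟙 (hasZero t) * compatibleCount X/e m t)
        ≡⟨ *-distribˡ-+ (𝟙 (distinct t)) _ _ ⟩
      viaX t + viaX/e t ∎

  sumDistinct-not-zeroThenOne-deleted :
    sumDistinct n n (λ τ → 𝟙 (not (zeroThenOne τ)) * compatibleCount X∖e m τ) ≡
    sumDistinct n n (λ τ → 𝟙 (not (zeroThenOne τ)) * compatibleCount X m τ)
  sumDistinct-not-zeroThenOne-deleted = sumSeqs-cong n λ τ →
    cong (𝟙 (distinct τ) *_) (𝟙-guard (not (zeroThenOne τ)) λ not-z1 →
      sumSeqs-cong (length τ) λ s →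
        cong 𝟙 (compatible-deleted τ s (trans (sym (not-involutive _)) (cong not not-z1))))

  redeiBerge-deletion-contraction : redeiBerge X∖e m ≡ redeiBerge X m + redeiBerge X/e m
  redeiBerge-deletion-contraction = begin
    redeiBerge X∖e m
      ≡⟨ redeiBerge≡sumDistinct X∖e m ⟩
    sumDistinct n n (compatibleCount X∖e m)
      ≡⟨ sumDistinct-split n n zeroThenOne (compatibleCount X∖e m) ⟩
    through (compatibleCount X∖e m) + avoiding (compatibleCount X∖e m)
      ≡⟨ cong₂ _+_ sumDistinct-zeroThenOne-deleted sumDistinct-not-zeroThenOne-deleted ⟩
    through (compatibleCount X m) + contracted + avoiding (compatibleCount X m)
      ≡⟨ [x+y]+z≡[x+z]+y (through (compatibleCount X m)) contracted _ ⟩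
    through (compatibleCount X m) + avoiding (compatibleCount X m) + contracted
      ≡⟨ cong (_+ contracted) (sumDistinct-split n n zeroThenOne (compatibleCount X m)) ⟨
    sumDistinct n n (compatibleCount X m) + contracted
      ≡⟨ cong₂ _+_ (redeiBerge≡sumDistinct X m) (redeiBerge≡sumDistinct X/e m) ⟨
    redeiBerge X m + redeiBerge X/e m ∎
    where
    open ≡-Reasoning
    through avoiding : (List (Fin n) → ℕ) → ℕ
    through  F = sumDistinct n n (λ τ → 𝟙 (zeroThenOne τ) * F τ)
    avoiding F = sumDistinct n n (λ τ → 𝟙 (not (zeroThenOne τ)) * F τ)
    contracted : ℕ
    contracted = sumDistinct (suc k) (suc k) (compatibleCount X/e m)

-- Iterated differences of rising factorials

sign-suc : ∀ n → sign (suc n) ≡ - sign n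
sign-suc zero    = refl
sign-suc (suc n) = trans (sym (ℤₚ.neg-involutive (sign n))) (cong -_ (sym (sign-suc n)))

neg-distrib-ℤsum : ∀ n (f : Fin n → ℤ) → ℤΣ.sum (λ i → - f i) ≡ - ℤΣ.sum f
neg-distrib-ℤsum zero    f = refl
neg-distrib-ℤsum (suc n) f = trans
  (cong (λ s → - f zero ℤ.+ s) (neg-distrib-ℤsum n (f ∘ suc)))
  (sym (ℤₚ.neg-distrib-+ (f zero) _))

foldr-map-applyUpTo : ∀ n (g : ℕ → ℤ) (f : ℕ → ℕ) →
  foldr ℤ._+_ (ℤ.+ 0) (map g (applyUpTo f n)) ≡ ℤΣ.sum {n} (λ j → g (f (toℕ j)))
foldr-map-applyUpTo zero    g f = refl
foldr-map-applyUpTo (suc n) g f = cong (λ s → g (f 0) ℤ.+ s) (foldr-map-applyUpTo n g (f ∘ suc))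

m≡n+o⇒+n≡+m-+o : ∀ {m n o} → m ≡ n + o → ℤ.+ n ≡ ℤ.+ m ℤ.- ℤ.+ o
m≡n+o⇒+n≡+m-+o {m} {n} {o} m≡n+o = begin
  ℤ.+ n                      ≡⟨ solve 2 (λ n o → n := (n :+ o) :- o) refl (ℤ.+ n) (ℤ.+ o) ⟩
  ℤ.+ n ℤ.+ ℤ.+ o ℤ.- ℤ.+ o  ≡⟨ cong (λ x → x ℤ.- ℤ.+ o) (ℤₚ.pos-+ n o) ⟨
  ℤ.+ (n + o) ℤ.- ℤ.+ o      ≡⟨ cong (λ x → ℤ.+ x ℤ.- ℤ.+ o) m≡n+o ⟨
  ℤ.+ m ℤ.- ℤ.+ o            ∎
  where
  open ≡-Reasoning
  open ℤ-Solver

module _ (m : ℕ) where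

  differenceTerm : ℕ → ℕ → ℕ → ℤ
  differenceTerm e l j = sign (e ∸ j) ℤ.* ℤ.+ ((e C j) * rising m (l + j))

  -- The e-th forward difference of l ↦ m(m+1)⋯(m+l-1), expanded binomially.
  differenceSum : ℕ → ℕ → ℤ
  differenceSum e l = ℤΣ.sum {suc e} (λ j → differenceTerm e l (toℕ j))

  differenceSum-zero : ∀ l → differenceSum 0 l ≡ ℤ.+ rising m l
  differenceSum-zero l = begin
    differenceTerm 0 l 0 ℤ.+ ℤ.+ 0        ≡⟨ ℤₚ.+-identityʳ _ ⟩
    ℤ.+ 1 ℤ.* ℤ.+ (1 * rising m (l + 0))  ≡⟨ ℤₚ.*-identityˡ _ ⟩
    ℤ.+ (1 * rising m (l + 0))            ≡⟨ cong ℤ.+_ (*-identityˡ _) ⟩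
    ℤ.+ rising m (l + 0)                  ≡⟨ cong (λ n → ℤ.+ rising m n) (+-identityʳ l) ⟩
    ℤ.+ rising m l                        ∎
    where open ≡-Reasoning

  rhs≡differenceSum : ∀ N l → rhs N l m ≡ differenceSum (N ∸ l) l
  rhs≡differenceSum N l = trans
    (foldr-map-applyUpTo (suc (N ∸ l))
      (λ j → sign (N ∸ (l + j)) ℤ.* ℤ.+ (((N ∸ l) C j) * rising m (l + j))) (λ j → j))
    (ℤΣ.sum-cong-≗ {suc (N ∸ l)} λ j →
      cong (λ n → sign n ℤ.* ℤ.+ (((N ∸ l) C toℕ j) * rising m (l + toℕ j))) (sym (∸-+-assoc N l (toℕ j))))

  differenceSum-suc : ∀ e l → differenceSum (suc e) l ≡ differenceSum e (suc l) ℤ.- differenceSum e l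
  differenceSum-suc e l = begin
    differenceTerm (suc e) l 0 ℤ.+ ℤΣ.sum {suc e} (λ i → differenceTerm (suc e) l (suc (toℕ i)))
      ≡⟨ cong₂ ℤ._+_ leading (trans (ℤΣ.sum-cong-≗ {suc e} pascal)
                                    (ℤΣ.∑-distrib-+ {suc e} (lower ∘ toℕ) (upper ∘ toℕ))) ⟩
    - t₀ ℤ.+ (ℤΣ.sum {suc e} (lower ∘ toℕ) ℤ.+ ℤΣ.sum {suc e} (upper ∘ toℕ))
      ≡⟨ cong₂ (λ a b → - t₀ ℤ.+ (a ℤ.+ b)) lower-sum upper-sum ⟩
    - t₀ ℤ.+ (differenceSum e (suc l) ℤ.+ - rest)
      ≡⟨ solve 3 (λ t d r → :- t :+ (d :+ :- r) := d :- (t :+ r)) refl t₀ (differenceSum e (suc l)) rest ⟩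
    differenceSum e (suc l) ℤ.- (t₀ ℤ.+ rest) ∎
    where
    open ≡-Reasoning
    open ℤ-Solver

    t₀ rest : ℤ
    t₀   = differenceTerm e l 0
    rest = ℤΣ.sum {e} (λ i → differenceTerm e l (suc (toℕ i)))

    lower upper : ℕ → ℤ
    lower i = sign (e ∸ i) ℤ.* ℤ.+ ((e C i) * rising m (l + suc i))
    upper i = sign (e ∸ i) ℤ.* ℤ.+ ((e C suc i) * rising m (l + suc i))

    leading : differenceTerm (suc e) l 0 ≡ - t₀
    leading = trans (cong (λ s → s ℤ.* c) (sign-suc e)) (sym (ℤₚ.neg-distribˡ-* (sign e) c))
      where
      c : ℤ
      c = ℤ.+ ((e C 0) * rising m (l + 0))

    pascal : ∀ i → differenceTerm (suc e) l (suc (toℕ i)) ≡ lower (toℕ i) ℤ.+ upper (toℕ i)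
    pascal i = begin
      sign (e ∸ j) ℤ.* ℤ.+ ((suc e C suc j) * r)
        ≡⟨ cong (λ c → sign (e ∸ j) ℤ.* ℤ.+ (c * r)) (sym (nCk+nC[k+1]≡[n+1]C[k+1] e j)) ⟩
      sign (e ∸ j) ℤ.* ℤ.+ ((e C j + e C suc j) * r)
        ≡⟨ cong (λ c → sign (e ∸ j) ℤ.* ℤ.+ c) (*-distribʳ-+ r (e C j) (e C suc j)) ⟩
      sign (e ∸ j) ℤ.* ℤ.+ ((e C j) * r + (e C suc j) * r)
        ≡⟨ cong (λ s → sign (e ∸ j) ℤ.* s) (ℤₚ.pos-+ ((e C j) * r) ((e C suc j) * r)) ⟩
      sign (e ∸ j) ℤ.* (ℤ.+ ((e C j) * r) ℤ.+ ℤ.+ ((e C suc j) * r))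
        ≡⟨ ℤₚ.*-distribˡ-+ (sign (e ∸ j)) _ _ ⟩
      lower j ℤ.+ upper j ∎
      where
      j r : ℕ
      j = toℕ i
      r = rising m (l + suc j)

    lower-sum : ℤΣ.sum {suc e} (lower ∘ toℕ) ≡ differenceSum e (suc l)
    lower-sum = ℤΣ.sum-cong-≗ {suc e} λ i →
      cong (λ n → sign (e ∸ toℕ i) ℤ.* ℤ.+ ((e C toℕ i) * rising m n)) (+-suc l (toℕ i))

    upper-sum : ℤΣ.sum {suc e} (upper ∘ toℕ) ≡ - rest
    upper-sum = begin
      ℤΣ.sum {suc e} (upper ∘ toℕ)
        ≡⟨ ℤΣ.sum-init-last {e} (upper ∘ toℕ) ⟩
      ℤΣ.sum {e} (upper ∘ toℕ ∘ inject₁) ℤ.+ upper (toℕ (fromℕ e))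
        ≡⟨ cong₂ ℤ._+_ (ℤΣ.sum-cong-≗ {e} (cong upper ∘ toℕ-inject₁)) (cong upper (toℕ-fromℕ e)) ⟩
      ℤΣ.sum {e} (upper ∘ toℕ) ℤ.+ upper e
        ≡⟨ cong₂ ℤ._+_ (ℤΣ.sum-cong-≗ {e} upper≡-term) last-vanishes ⟩
      ℤΣ.sum {e} (λ i → - differenceTerm e l (suc (toℕ i))) ℤ.+ ℤ.+ 0
        ≡⟨ ℤₚ.+-identityʳ _ ⟩
      ℤΣ.sum {e} (λ i → - differenceTerm e l (suc (toℕ i)))
        ≡⟨ neg-distrib-ℤsum e (λ i → differenceTerm e l (suc (toℕ i))) ⟩
      - rest ∎
      where
      last-vanishes : upper e ≡ ℤ.+ 0
      last-vanishes = trans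
        (cong (λ c → sign (e ∸ e) ℤ.* ℤ.+ (c * rising m (l + suc e))) (k>n⇒nCk≡0 (n<1+n e)))
        (ℤₚ.*-zeroʳ (sign (e ∸ e)))
      upper≡-term : ∀ (i : Fin e) → upper (toℕ i) ≡ - differenceTerm e l (suc (toℕ i))
      upper≡-term i = begin
        sign (e ∸ toℕ i) ℤ.* c              ≡⟨ cong (λ n → sign n ℤ.* c) (+-∸-assoc 1 (toℕ<n i)) ⟩
        sign (suc (e ∸ suc (toℕ i))) ℤ.* c  ≡⟨ cong (λ s → s ℤ.* c) (sign-suc (e ∸ suc (toℕ i))) ⟩
        - sign (e ∸ suc (toℕ i)) ℤ.* c      ≡⟨ ℤₚ.neg-distribˡ-* (sign (e ∸ suc (toℕ i))) c ⟨
        - differenceTerm e l (suc (toℕ i))  ∎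
        where
        c : ℤ
        c = ℤ.+ ((e C suc (toℕ i)) * rising m (l + suc (toℕ i)))

-- Induction on the number of edges

-- h vanishes from the last vertex on, so edgeCount n h counts the edges of pathGraph n h
-- and the condition survives shifting h.
EdgesWithin : ℕ → (ℕ → Bool) → Set
EdgesWithin n h = ∀ a → n ≤ suc a → h a ≡ false

edgeCount : ℕ → (ℕ → Bool) → ℕ
edgeCount zero    h = 0
edgeCount (suc n) h = 𝟙 (h 0) + edgeCount n (h ∘ suc)

edgeCount-suc : ∀ n h → edgeCount (suc n) h ≡ edgeCount n h + 𝟙 (h n)
edgeCount-suc zero    h = +-identityʳ (𝟙 (h 0))
edgeCount-suc (suc n) h =
  trans (cong (𝟙 (h 0) +_) (edgeCount-suc n (h ∘ suc))) (sym (+-assoc (𝟙 (h 0)) _ _))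

edgeCount≤ : ∀ n h → edgeCount n h ≤ n
edgeCount≤ zero    h = ℕ.z≤n
edgeCount≤ (suc n) h = +-mono-≤ (𝟙≤1 (h 0)) (edgeCount≤ n (h ∘ suc))
  where
  𝟙≤1 : ∀ b → 𝟙 b ≤ 1
  𝟙≤1 true  = ≤-refl
  𝟙≤1 false = ℕ.z≤n

edgeCount≡0 : ∀ n h → edgeCount n h ≡ 0 → ∀ a → a < n → h a ≡ false
edgeCount≡0 (suc n) h edges≡0 a a<1+n with h 0 in h0
edgeCount≡0 (suc n) h edges≡0 zero    _         | false = h0
edgeCount≡0 (suc n) h edges≡0 (suc a) (s≤s a<n) | false = edgeCount≡0 n (h ∘ suc) edges≡0 a a<n

edgeCount≡suc : ∀ n h e → edgeCount n h ≡ suc e → Σ ℕ (λ j → h j ≡ true)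
edgeCount≡suc (suc n) h e edges with h 0 in h0
... | true  = 0 , h0
... | false with edgeCount≡suc n (h ∘ suc) e edges
...   | j , hj = suc j , hj

pathGraph-edgeless : ∀ n h → (∀ a → a < n → h a ≡ false) → ∀ a b → edge (pathGraph n h) a b ≡ false
pathGraph-edgeless n h no-edges a b =
  trans (cong ((toℕ b ≡ᵇ suc (toℕ a)) ∧_) (no-edges (toℕ a) (toℕ<n a))) (∧-zeroʳ _)

-- 0 ↦ n and i + 1 ↦ i.
rotation : ∀ n → Permutation (suc n) (suc n)
rotation n = insert zero (fromℕ n) Perm.id

toℕ-rotation-suc : ∀ n (i : Fin n) → toℕ (rotation n ⟨$⟩ʳ suc i) ≡ toℕ i
toℕ-rotation-suc n i = trans (cong toℕ (insert-punchIn zero (fromℕ n) Perm.id i)) (toℕ-punchIn-fromℕ n i)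
  where
  toℕ-punchIn-fromℕ : ∀ n (i : Fin n) → toℕ (Fin.punchIn (fromℕ n) i) ≡ toℕ i
  toℕ-punchIn-fromℕ (suc n) zero    = refl
  toℕ-punchIn-fromℕ (suc n) (suc i) = cong suc (toℕ-punchIn-fromℕ n i)

redeiBerge-rotate : ∀ n h → h 0 ≡ false → EdgesWithin (suc n) h →
  ∀ m → redeiBerge (pathGraph (suc n) h) m ≡ redeiBerge (pathGraph (suc n) (h ∘ suc)) m
redeiBerge-rotate n h h0 within = redeiBerge-relabel _ _ (rotation n) preserves
  where
  preserves : ∀ a b → edge (pathGraph (suc n) (h ∘ suc)) (rotation n ⟨$⟩ʳ a) (rotation n ⟨$⟩ʳ b)
                    ≡ edge (pathGraph (suc n) h) a b
  preserves zero b rewrite toℕ-fromℕ n | within (suc n) (n≤1+n (suc n)) | h0 =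
    trans (∧-zeroʳ _) (sym (∧-zeroʳ _))
  preserves (suc i) zero rewrite toℕ-rotation-suc n i | toℕ-fromℕ n with n ≡ᵇ suc (toℕ i) in n≡i+1
  ... | false = refl
  ... | true  = within (suc (toℕ i)) (s≤s (≤-reflexive (≡ᵇ⇒≡ n _ (subst T (sym n≡i+1) _))))
  preserves (suc i) (suc j) rewrite toℕ-rotation-suc n i | toℕ-rotation-suc n j = refl

module _ (m : ℕ) where

  PathFormula : ℕ → Set
  PathFormula e = ∀ n h → EdgesWithin n h → edgeCount n h ≡ e →
    ℤ.+ redeiBerge (pathGraph n h) m ≡ differenceSum m e (n ∸ e)

  pathFormula-zero : PathFormula 0
  pathFormula-zero n h _ edges≡0 = begin
    ℤ.+ redeiBerge (pathGraph n h) m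
      ≡⟨ cong ℤ.+_ (redeiBerge-edgeless (pathGraph n h) (pathGraph-edgeless n h (edgeCount≡0 n h edges≡0))) ⟩
    ℤ.+ rising m n
      ≡⟨ differenceSum-zero m n ⟨
    differenceSum m 0 n ∎
    where open ≡-Reasoning

  pathFormula-firstEdge : ∀ {e} → PathFormula e → ∀ k h → h 0 ≡ true →
    EdgesWithin (suc (suc k)) h → edgeCount (suc (suc k)) h ≡ suc e →
    ℤ.+ redeiBerge (pathGraph (suc (suc k)) h) m ≡ differenceSum m (suc e) (suc k ∸ e)
  pathFormula-firstEdge {e} IH k h h0 within edges = begin
    ℤ.+ redeiBerge X m
      ≡⟨ m≡n+o⇒+n≡+m-+o redeiBerge-deletion-contraction ⟩
    ℤ.+ redeiBerge X∖e m ℤ.- ℤ.+ redeiBerge X/e m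
      ≡⟨ cong₂ ℤ._-_ (IH (suc (suc k)) (withoutFirstEdge h) within∖e edges′)
                     (IH (suc k) (h ∘ suc) within/e edges′) ⟩
    differenceSum m e (suc (suc k) ∸ e) ℤ.- differenceSum m e (suc k ∸ e)
      ≡⟨ cong (λ l → differenceSum m e l ℤ.- differenceSum m e (suc k ∸ e)) (+-∸-assoc 1 e≤1+k) ⟩
    differenceSum m e (suc (suc k ∸ e)) ℤ.- differenceSum m e (suc k ∸ e)
      ≡⟨ differenceSum-suc m e (suc k ∸ e) ⟨
    differenceSum m (suc e) (suc k ∸ e) ∎
    where
    open ≡-Reasoning
    open DeletionContraction {k} h h0 m
    edges′ : edgeCount (suc k) (h ∘ suc) ≡ e
    edges′ = suc-injective (trans (cong (λ b → 𝟙 b + edgeCount (suc k) (h ∘ suc)) (sym h0)) edges)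
    e≤1+k : e ≤ suc k
    e≤1+k = subst (_≤ suc k) edges′ (edgeCount≤ (suc k) (h ∘ suc))
    within∖e : EdgesWithin (suc (suc k)) (withoutFirstEdge h)
    within∖e zero    _  = refl
    within∖e (suc a) n≤ = within (suc a) n≤
    within/e : EdgesWithin (suc k) (h ∘ suc)
    within/e a n≤ = within (suc a) (s≤s n≤)

  pathFormula-suc : ∀ {e} → PathFormula e → ∀ j n h → h j ≡ true → EdgesWithin n h →
    edgeCount n h ≡ suc e → ℤ.+ redeiBerge (pathGraph n h) m ≡ differenceSum m (suc e) (n ∸ suc e)
  pathFormula-suc IH zero    (suc zero)    h h0 within edges with () ← trans (sym h0) (within 0 ≤-refl)
  pathFormula-suc IH zero    (suc (suc k)) h h0 within edges = pathFormula-firstEdge IH k h h0 within edges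
  pathFormula-suc IH (suc j) (suc n)       h hj within edges with h 0 ≟ᵇ true
  ... | yes h0 = pathFormula-suc IH zero (suc n) h h0 within edges
  ... | no ¬h0 = trans (cong ℤ.+_ (redeiBerge-rotate n h h0 within m))
                       (pathFormula-suc IH j (suc n) (h ∘ suc) hj within′ (trans edges′ edges))
    where
    h0 : h 0 ≡ false
    h0 = ¬-not ¬h0
    within′ : EdgesWithin (suc n) (h ∘ suc)
    within′ a n≤ = within (suc a) (m≤n⇒m≤1+n n≤)
    edges′ : edgeCount (suc n) (h ∘ suc) ≡ edgeCount (suc n) h
    edges′ = begin
      edgeCount (suc n) (h ∘ suc)
        ≡⟨ edgeCount-suc n (h ∘ suc) ⟩
      edgeCount n (h ∘ suc) + 𝟙 (h (suc n))
        ≡⟨ cong (λ b → edgeCount n (h ∘ suc) + 𝟙 b) (within (suc n) (n≤1+n (suc n))) ⟩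
      edgeCount n (h ∘ suc) + 0
        ≡⟨ +-comm _ 0 ⟩
      𝟙 false + edgeCount n (h ∘ suc)
        ≡⟨ cong (λ b → 𝟙 b + edgeCount n (h ∘ suc)) h0 ⟨
      edgeCount (suc n) h ∎
      where open ≡-Reasoning

  pathFormula : ∀ e → PathFormula e
  pathFormula zero    = pathFormula-zero
  pathFormula (suc e) n h within edges with edgeCount≡suc n h e edges
  ... | j , hj = pathFormula-suc (pathFormula e) j n h hj within edges

-- The path forest of a partition

hasPathEdge : List ℕ → ℕ → Bool
hasPathEdge λs a = not (isLastInBlock λs a)

edgesWithin-∷ : ∀ p ps → EdgesWithin (sum ps) (hasPathEdge ps) →
  EdgesWithin (suc p + sum ps) (hasPathEdge (suc p ∷ ps))
edgesWithin-∷ zero    ps within zero    _        = refl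
edgesWithin-∷ zero    ps within (suc a) (s≤s n≤) = within a n≤
edgesWithin-∷ (suc p) ps within (suc a) (s≤s n≤) = edgesWithin-∷ p ps within a n≤

edgesWithin-P : ∀ λs → AllPos λs → EdgesWithin (sum λs) (hasPathEdge λs)
edgesWithin-P []           []        a _ = refl
edgesWithin-P (suc p ∷ λs) (_ ∷ pos) = edgesWithin-∷ p λs (edgesWithin-P λs pos)

edgeCount-∷ : ∀ p ps → edgeCount (sum ps) (hasPathEdge ps) + length ps ≡ sum ps →
  edgeCount (suc p + sum ps) (hasPathEdge (suc p ∷ ps)) + suc (length ps) ≡ suc p + sum ps
edgeCount-∷ zero    ps edges = trans (+-suc _ (length ps)) (cong suc edges)
edgeCount-∷ (suc p) ps edges = cong suc (edgeCount-∷ p ps edges)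

edgeCount-P : ∀ λs → AllPos λs → edgeCount (sum λs) (hasPathEdge λs) + length λs ≡ sum λs
edgeCount-P []           []        = refl
edgeCount-P (suc p ∷ λs) (_ ∷ pos) = edgeCount-∷ p λs (edgeCount-P λs pos)

open import Data.Integer using (+_)

mainTheorem20 : (λs : List ℕ) → IsPartition λs → (m : ℕ) →
    + (redeiBerge (P λs) m) ≡ rhs (sum λs) (length λs) m
mainTheorem20 λs (_ , pos) m = begin
  + redeiBerge (pathGraph N (hasPathEdge λs)) m
    ≡⟨ pathFormula m (N ∸ l) N (hasPathEdge λs) (edgesWithin-P λs pos) edges ⟩
  differenceSum m (N ∸ l) (N ∸ (N ∸ l))
    ≡⟨ cong (differenceSum m (N ∸ l)) (m∸[m∸n]≡n l≤N) ⟩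
  differenceSum m (N ∸ l) l
    ≡⟨ rhs≡differenceSum m N l ⟨
  rhs N l m ∎
  where
  open ≡-Reasoning
  N l : ℕ
  N = sum λs
  l = length λs
  l≤N : l ≤ N
  l≤N = subst (l ≤_) (edgeCount-P λs pos) (m≤n+m l _)
  edges : edgeCount N (hasPathEdge λs) ≡ N ∸ l
  edges = trans (sym (m+n∸n≡m _ l)) (cong (_∸ l) (edgeCount-P λs pos))
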